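{- Let $\langle L_i:i\in\omega\rangle$ be a sequence in $\mathcal H$ satisfying condition $(*)$, and let $L=\sum_\omega L_i$. Then: (a) A set $A\subseteq L$ contains an element of $\mathbb P(L)$ (i.e. a subset isomorphic to $L$) if and only if for all $i,m\in\omega$ there is a finite $K\subseteq\omega\setminus m$ such that $L_i\hookrightarrow \big(\bigcup_{j\in K}L_j\big)\cap A$. Consequently each $A\in\mathbb P(L)$ intersects infinitely many $L_i$. (b) For $A,B\in\mathbb P(L)$: $A\le B$ if and only if for every $C\in\mathbb P(L)$ with $C\subseteq A$ and all $i,m\in\omega$ there is a finite $K\subseteq\omega\setminus m$ such that $L_i\hookrightarrow\big(\bigcup_{j\in K}L_j\big)\cap C\cap B$. (c) The pre-order $\langle\mathbb P(L),\le\rangle$ is $\sigma$-closed. The same statements (a)–(c) hold when $L=\sum_{\omega^*}L_i$ instead of $\sum_\omega L_i$.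
   Context: $X\hookrightarrow Y$ means that the linear order $X$ order-embeds into the linear order $Y$; subsets of a linear order carry the induced order. For a sequence $\langle L_i:i\in\omega\rangle$ of linear orders, $\sum_\omega L_i=L_0+L_1+L_2+\cdots$ is the ordered sum indexed by $\omega$, and $\sum_{\omega^*}L_i=\cdots+L_2+L_1+L_0$ is the ordered sum indexed by the reverse order of $\omega$. A sequence $\langle L_i:i\in\omega\rangle$ satisfies condition $(*)$ if for every $i\in\omega$ the set $\{j\in\omega: L_i\hookrightarrow L_j\}$ is infinite. $\mathcal H$ (the hereditarily additively indecomposable orders) is the smallest class of order types of countable linear orders containing the one-element order type and containing $\sum_\omega L_i$ and $\sum_{\omega^*}L_i$ for every sequence $\langle L_i\rangle$ in $\mathcal H$ satisfying $(*)$. For a linear order $L$, $\mathbb P(L)=\{A\subseteq L:A\cong L\}$, and $\le$ denotes the separative modification of $\subseteq$ on $\mathbb P(L)$: $A\le B$ iff for every $C\in\mathbb P(L)$ with $C\subseteq A$ there is $D\in\mathbb P(L)$ with $D\subseteq C\cap B$. A pre-order is $\sigma$-closed if every sequence $p_0\ge p_1\ge\cdots$ has a lower bound. For $m\in\omega$, $\omega\setminus m=\{n\in\omega:n\ge m\}$. -}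

module Defs where

open import Level using (0ℓ)
open import Data.Nat using (ℕ; _≤_; _<_; _≡ᵇ_)
open import Data.Bool using (Bool; true; _∧_)
open import Data.Unit using (⊤)
open import Data.Empty using (⊥)
open import Data.List using (List)
open import Data.Bool.ListAction using (any)
open import Data.List.Relation.Unary.All using (All)
open import Data.Product using (Σ; ∃; ∃-syntax; _×_; _,_; proj₁)
open import Relation.Binary.PropositionalEquality using (_≡_)
open import Function.Bundles using (_⇔_)

-- Linearity is not
-- built in; all orders in the statement are forced to be linear by membership
-- in 𝓗 (or are subsets of such orders with the induced order).
record Ord : Set₁ where
  field
    Carrier : Set
    lt      : Carrier → Carrier → Set
open Ord public

_↪_ : Ord → Ord → Set
X ↪ Y = Σ (Carrier X → Carrier Y) λ f →
          ∀ x y → (lt X x y → lt Y (f x) (f y)) × (lt Y (f x) (f y) → lt X x y)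

record _≅_ (X Y : Ord) : Set where
  field
    to      : Carrier X → Carrier Y
    from    : Carrier Y → Carrier X
    from-to : ∀ x → from (to x) ≡ x
    to-from : ∀ y → to (from y) ≡ y
    to-<    : ∀ x x' → lt X x x' ⇔ lt Y (to x) (to x')

-- Subsets (Boolean-valued characteristic functions; classically all subsets)
Subset : Ord → Set
Subset X = Carrier X → Bool


Sub⊆ : (X : Ord) → Subset X → Subset X → Set
Sub⊆ X A B = ∀ (x : Carrier X) → A x ≡ true → B x ≡ true

Sub∩ : (X : Ord) → Subset X → Subset X → Subset X
Sub∩ X A B x = A x ∧ B x

_∣_ : (X : Ord) → Subset X → Ord
Carrier (X ∣ A) = Σ (Carrier X) λ x → A x ≡ true
lt (X ∣ A) a b = lt X (proj₁ a) (proj₁ b)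

𝟙 : Ord
Carrier 𝟙 = ⊤
lt 𝟙 _ _ = ⊥

data Dir : Set where
  ω ω* : Dir

IdxLt : Dir → ℕ → ℕ → Set
IdxLt ω  i j = i < j
IdxLt ω* i j = j < i

data SumLt (d : Dir) (Ls : ℕ → Ord) : Σ ℕ (λ i → Carrier (Ls i)) → Σ ℕ (λ i → Carrier (Ls i)) → Set where
  lt-idx : ∀ {i j x y} → IdxLt d i j → SumLt d Ls (i , x) (j , y)
  lt-in  : ∀ {i x y} → lt (Ls i) x y → SumLt d Ls (i , x) (i , y)

Sum : Dir → (ℕ → Ord) → Ord
Carrier (Sum d Ls) = Σ ℕ (λ i → Carrier (Ls i))
lt (Sum d Ls) = SumLt d Ls

-- Condition (*): for every i, {j | L_i ↪ L_j} is infinite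
Star : (ℕ → Ord) → Set
Star Ls = ∀ i n → ∃[ j ] (n ≤ j × (Ls i ↪ Ls j))

-- The class 𝓗 (closed under isomorphism, i.e. a class of order types)
data InH : Ord → Set₁ where
  one : ∀ {X} → X ≅ 𝟙 → InH X
  sum : ∀ {X} (d : Dir) (Ls : ℕ → Ord) → (∀ i → InH (Ls i)) → Star Ls → X ≅ Sum d Ls → InH X

InP : (L : Ord) → Subset L → Set
InP L A = (L ∣ A) ≅ L

-- Separative modification of ⊆ on ℙ(L)

SepLe : (L : Ord) → Subset L → Subset L → Set
SepLe L A B = ∀ (C : Subset L) → InP L C → Sub⊆ L C A → ∃[ D ] (InP L D × Sub⊆ L D (Sub∩ L C B))

UnionK : (d : Dir) (Ls : ℕ → Ord) → List ℕ → Subset (Sum d Ls)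
UnionK d Ls K (j , _) = any (λ k → j ≡ᵇ k) K

SigmaClosed : (L : Ord) → Set
SigmaClosed L = ∀ (p : ℕ → Subset L) → (∀ n → InP L (p n)) →
                (∀ n → SepLe L (p (Data.Nat.suc n)) (p n)) →
                ∃[ q ] (InP L q × (∀ n → SepLe L q (p n)))

-- The engine is that no X ∈ 𝓗 "doubles": X + X never maps monotonically into X
-- (H-noDoubles, by induction on 𝓗).  A monotone self-map of a sum with bounded
-- block indices settles in one block L_l (eventuallyOneBlock), and shifting the
-- sum beyond that point by (*) maps all of it, hence L_l + L_l, into L_l.  So
-- every self-embedding of L reaches arbitrarily late blocks (unboundedBlocks),
-- and a copy of L_i in a late block is carried into finitely many late blocks:
-- (a) ⇒ (copy⇒spread).  Conversely, placing the blocks L_n one after another in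
-- disjoint intervals of blocks gives a self-embedding whose image is a copy of
-- L (assemble, image-inP): (a) ⇐.  Part (b) is (a) for C ∩ B, as A ≤ B says that
-- C ∩ B contains a copy of L for every copy C ⊆ A.  For (c) each p₀, …, pₙ gets a
-- common refinement (commonRefinement), and block n is assembled into the n-th.
module Submission where

open import Defs
open import Level using (0ℓ)
import Level
open import Axiom.ExcludedMiddle using (ExcludedMiddle)
open import Axiom.UniquenessOfIdentityProofs using (module Decidable⇒UIP)
open import Data.Bool using (true; _∧_)
import Data.Bool as Bool
open import Data.Bool.Properties using (T-≡; ∧-assoc)
open import Data.Empty using (⊥-elim)
open import Data.Unit using (tt)
open import Data.Nat using (ℕ; zero; suc; _≤_; _<_; _⊔_; _+_; _≡ᵇ_; s≤s; z≤n; _≟_)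
open import Data.Nat.Properties
open import Data.List using (List; applyUpTo)
open import Data.List.Extrema.Nat using (max; xs≤max)
open import Data.List.Membership.Propositional using (_∈_)
open import Data.List.Membership.Propositional.Properties using (∈-applyUpTo⁺)
open import Data.List.Relation.Unary.All using (All)
import Data.List.Relation.Unary.All as All
open import Data.List.Relation.Unary.All.Properties using (applyUpTo⁺₂)
import Data.List.Relation.Unary.Any as Any
open import Data.List.Relation.Unary.Any.Properties using (any⁺; any⁻)
open import Data.Product using (Σ; _×_; _,_; ∃-syntax; proj₁; proj₂; map₁; uncurry)
open import Data.Sum using (_⊎_; inj₁; inj₂; [_,_]′)
import Data.Sum as Sum
open import Function.Bundles using (_⇔_; mk⇔; Equivalence)
open import Relation.Binary.Definitions using (tri<; tri≈; tri>)
open import Relation.Binary.PropositionalEquality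
open import Relation.Nullary using (Dec; yes; no; ¬_)
open import Relation.Nullary.Decidable.Core using (isYes; toWitness; fromWitness; map′)

Monotone : (X Y : Ord) → (Carrier X → Carrier Y) → Set
Monotone X Y f = ∀ x y → lt X x y → lt Y (f x) (f y)

Trichotomous : Ord → Set
Trichotomous X = ∀ a b → lt X a b ⊎ (a ≡ b ⊎ lt X b a)

Irreflexive : Ord → Set
Irreflexive X = ∀ a → ¬ lt X a a

-- Order embeddings X ↪ Y packaged as a record, so that X and Y can be inferred.
record Embedding (X Y : Ord) : Set where
  field
    emb          : Carrier X → Carrier Y
    emb-mono     : Monotone X Y emb
    emb-reflects : ∀ x y → lt Y (emb x) (emb y) → lt X x y
open Embedding public

embedding : {X Y : Ord} → X ↪ Y → Embedding X Y
embedding (f , f-emb) = record { emb = f ; emb-mono = λ x y → proj₁ (f-emb x y) ; emb-reflects = λ x y → proj₂ (f-emb x y) }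

↪-of : {X Y : Ord} → Embedding X Y → X ↪ Y
↪-of e = emb e , λ x y → emb-mono e x y , emb-reflects e x y

_∘ᵉ_ : {X Y Z : Ord} → Embedding Y Z → Embedding X Y → Embedding X Z
g ∘ᵉ f = record
  { emb          = λ x → emb g (emb f x)
  ; emb-mono     = λ x y r → emb-mono g _ _ (emb-mono f x y r)
  ; emb-reflects = λ x y r → emb-reflects f x y (emb-reflects g _ _ r) }

emb-injective : {X Y : Ord} (e : Embedding X Y) → Trichotomous X → Irreflexive Y →
                ∀ x y → emb e x ≡ emb e y → x ≡ y
emb-injective {Y = Y} e tri irr x y ex≡ey with tri x y
... | inj₁ x<y        = ⊥-elim (irr (emb e y) (subst (λ z → lt Y z (emb e y)) ex≡ey (emb-mono e x y x<y)))
... | inj₂ (inj₁ x≡y) = x≡y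
... | inj₂ (inj₂ y<x) = ⊥-elim (irr (emb e y) (subst (lt Y (emb e y)) ex≡ey (emb-mono e y x y<x)))

≅⇒emb : {X Y : Ord} → X ≅ Y → Embedding X Y
≅⇒emb I = record { emb = to ; emb-mono = λ x y → Equivalence.to (to-< x y) ; emb-reflects = λ x y → Equivalence.from (to-< x y) }
  where open _≅_ I

≅⇒emb⁻¹ : {X Y : Ord} → X ≅ Y → Embedding Y X
≅⇒emb⁻¹ {Y = Y} I = record
  { emb          = from
  ; emb-mono     = λ y y' r → Equivalence.from (to-< _ _) (subst₂ (lt Y) (sym (to-from y)) (sym (to-from y')) r)
  ; emb-reflects = λ y y' r → subst₂ (lt Y) (to-from y) (to-from y') (Equivalence.to (to-< _ _) r) }
  where open _≅_ I

forget : (X : Ord) (P : Subset X) → Embedding (X ∣ P) X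
forget X P = record { emb = proj₁ ; emb-mono = λ _ _ r → r ; emb-reflects = λ _ _ r → r }

corestrict : {X Y : Ord} (e : Embedding Y X) (P : Subset X) → (∀ y → P (emb e y) ≡ true) → Embedding Y (X ∣ P)
corestrict e P inP = record { emb = λ y → emb e y , inP y ; emb-mono = emb-mono e ; emb-reflects = emb-reflects e }

enlarge : (X : Ord) {Y : Ord} {P Q : Subset X} → Sub⊆ X P Q → Y ↪ (X ∣ P) → Y ↪ (X ∣ Q)
enlarge X P⊆Q (f , f-emb) = (λ y → proj₁ (f y) , P⊆Q _ (proj₂ (f y))) , f-emb

subset-≡ : {X : Ord} {P : Subset X} {x x' : Carrier X} {p : P x ≡ true} {p' : P x' ≡ true} →
           x ≡ x' → _≡_ {A = Carrier (X ∣ P)} (x , p) (x' , p')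
subset-≡ {p = p} {p'} refl = cong (_ ,_) (Decidable⇒UIP.≡-irrelevant Bool._≟_ p p')

trichotomous-≅ : {X Y : Ord} → X ≅ Y → Trichotomous Y → Trichotomous X
trichotomous-≅ I tri a b =
  Sum.map (emb-reflects (≅⇒emb I) a b) (Sum.map same (emb-reflects (≅⇒emb I) b a)) (tri (to a) (to b))
  where
  open _≅_ I
  same : to a ≡ to b → a ≡ b
  same e = trans (sym (from-to a)) (trans (cong from e) (from-to b))

irreflexive-emb : {X Y : Ord} → Embedding X Y → Irreflexive Y → Irreflexive X
irreflexive-emb e irr a r = irr (emb e a) (emb-mono e a a r)

-- X doubles when X + X maps monotonically into X: two monotone self-maps with
-- every value of the first below every value of the second.
record Doubles (X : Ord) : Set where
  field
    left right : Carrier X → Carrier X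
    left-mono  : Monotone X X left
    right-mono : Monotone X X right
    left<right : ∀ a b → lt X (left a) (right b)

doubles-via : {X Z : Ord} (φ ψ : Carrier X → Carrier Z) (E : Carrier Z → Carrier X) →
              Monotone X Z φ → Monotone X Z ψ → (∀ a b → lt Z (φ a) (ψ b)) → Monotone Z X E → Doubles X
doubles-via φ ψ E φ-mono ψ-mono φ<ψ E-mono = record
  { left       = λ a → E (φ a)
  ; right      = λ a → E (ψ a)
  ; left-mono  = λ a b r → E-mono _ _ (φ-mono a b r)
  ; right-mono = λ a b r → E-mono _ _ (ψ-mono a b r)
  ; left<right = λ a b → E-mono _ _ (φ<ψ a b) }

doubles-≅ : {X Y : Ord} → X ≅ Y → Doubles X → Doubles Y
doubles-≅ I D = doubles-via (λ y → left (emb from y)) (λ y → right (emb from y)) (emb to)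
  (λ a b r → left-mono _ _ (emb-mono from a b r)) (λ a b r → right-mono _ _ (emb-mono from a b r))
  (λ a b → left<right _ _) (emb-mono to)
  where
  open Doubles D
  to = ≅⇒emb I
  from = ≅⇒emb⁻¹ I

orient : ∀ d {i j} → i < j → IdxLt d i j ⊎ IdxLt d j i
orient ω  i<j = inj₁ i<j
orient ω* i<j = inj₂ i<j

idxLt-irrefl : ∀ d {i} → ¬ IdxLt d i i
idxLt-irrefl ω  = <-irrefl refl
idxLt-irrefl ω* = <-irrefl refl

idxLt-along : ∀ d {n n' i j} → (n < n' → i < j) → (n' < n → j < i) → IdxLt d n n' → IdxLt d i j
idxLt-along ω  along _    = along
idxLt-along ω* _    back = back

idxLt-back : ∀ d {n n' i j} → (n < n' → i < j) → (n' < n → j < i) →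
             IdxLt d i j ⊎ i ≡ j → n ≢ n' → IdxLt d n n'
idxLt-back ω {n} {n'} along back i≤j n≢n' with <-cmp n n'
... | tri< n<n' _ _ = n<n'
... | tri≈ _ n≡n' _ = ⊥-elim (n≢n' n≡n')
... | tri> _ _ n'<n = ⊥-elim (<⇒≱ (back n'<n) ([ <⇒≤ , ≤-reflexive ]′ i≤j))
idxLt-back ω* {n} {n'} along back i≤j n≢n' with <-cmp n n'
... | tri< n<n' _ _ = ⊥-elim (<⇒≱ (along n<n') ([ <⇒≤ , (λ i≡j → ≤-reflexive (sym i≡j)) ]′ i≤j))
... | tri≈ _ n≡n' _ = ⊥-elim (n≢n' n≡n')
... | tri> _ _ n'<n = n'<n

idx-nondecreasing : ∀ d {n n' i j} → n < n' →
                    (IdxLt d n n' → IdxLt d i j ⊎ i ≡ j) → (IdxLt d n' n → IdxLt d j i ⊎ j ≡ i) → i ≤ j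
idx-nondecreasing ω  n<n' along _ = [ <⇒≤ , ≤-reflexive ]′ (along n<n')
idx-nondecreasing ω* n<n' _ back  = [ <⇒≤ , (λ j≡i → ≤-reflexive (sym j≡i)) ]′ (back n<n')

increasing⇒strict : (f : ℕ → ℕ) → (∀ n → f n < f (suc n)) → ∀ {n n'} → n < n' → f n < f n'
increasing⇒strict f step {n} {suc n'} (s≤s n≤n') with m≤n⇒m<n∨m≡n n≤n'
... | inj₁ n<n' = <-trans (increasing⇒strict f step n<n') (step n')
... | inj₂ refl = step n

module SumOrder (d : Dir) (Ls : ℕ → Ord) where

  S : Ord
  S = Sum d Ls

  U : List ℕ → Subset S
  U = UnionK d Ls

  FitsBeyond : ℕ → ℕ → Subset S → Set
  FitsBeyond i m A = ∃[ K ] (All (m ≤_) K × (Ls i ↪ (S ∣ Sub∩ S (U K) A)))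

  Spread : Subset S → Set
  Spread A = ∀ i m → FitsBeyond i m A

  ContainsCopy : Subset S → Set
  ContainsCopy A = ∃[ B ] (InP S B × Sub⊆ S B A)

  U⇒∈ : ∀ K x → U K x ≡ true → proj₁ x ∈ K
  U⇒∈ K (j , _) j∈U = Any.map (λ {k} → ≡ᵇ⇒≡ j k) (any⁻ (j ≡ᵇ_) K (Equivalence.from T-≡ j∈U))

  ∈⇒U : ∀ K x → proj₁ x ∈ K → U K x ≡ true
  ∈⇒U K (j , _) j∈K = Equivalence.to T-≡ (any⁺ (j ≡ᵇ_) (Any.map (λ {k} j≡k → ≡⇒≡ᵇ j k j≡k) j∈K))

  interval : ℕ → ℕ → List ℕ
  interval m N = applyUpTo (m +_) (suc N)

  interval-above : ∀ m N → All (m ≤_) (interval m N)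
  interval-above m N = applyUpTo⁺₂ (m +_) (suc N) (m≤m+n m)

  interval-∋ : ∀ {m N k} → m ≤ k → k ≤ N → k ∈ interval m N
  interval-∋ {m} {N} {k} m≤k k≤N =
    subst (_∈ interval m N) (m+[n∸m]≡n m≤k) (∈-applyUpTo⁺ (m +_) (s≤s (≤-trans (m∸n≤m k m) k≤N)))

  sumLt-blocks : ∀ {p q} → lt S p q → IdxLt d (proj₁ p) (proj₁ q) ⊎ proj₁ p ≡ proj₁ q
  sumLt-blocks (lt-idx r) = inj₁ r
  sumLt-blocks (lt-in _)  = inj₂ refl

  sumLt-within : ∀ {i a b} → lt S (i , a) (i , b) → lt (Ls i) a b
  sumLt-within (lt-idx r) = ⊥-elim (idxLt-irrefl d r)
  sumLt-within (lt-in r)  = r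

  sum-trichotomous : (∀ i → Trichotomous (Ls i)) → Trichotomous S
  sum-trichotomous tri (i , a) (j , b) with <-cmp i j
  ... | tri< i<j _ _ = [ (λ r → inj₁ (lt-idx r)) , (λ r → inj₂ (inj₂ (lt-idx r))) ]′ (orient d i<j)
  ... | tri> _ _ j<i = [ (λ r → inj₂ (inj₂ (lt-idx r))) , (λ r → inj₁ (lt-idx r)) ]′ (orient d j<i)
  ... | tri≈ _ refl _ = Sum.map lt-in (Sum.map (cong (i ,_)) lt-in) (tri i a b)

  sum-irreflexive : (∀ i → Irreflexive (Ls i)) → Irreflexive S
  sum-irreflexive irr (i , a) r = irr i a (sumLt-within r)

  blockInclusion : ∀ j → Embedding (Ls j) S
  blockInclusion j = record { emb = j ,_ ; emb-mono = λ _ _ → lt-in ; emb-reflects = λ _ _ → sumLt-within }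

  blockwise : (ι : ∀ n → Embedding (Ls n) S) →
              (∀ {n n'} a b → n < n' → proj₁ (emb (ι n) a) < proj₁ (emb (ι n') b)) → Embedding S S
  blockwise ι separated = record { emb = map ; emb-mono = mono ; emb-reflects = reflects }
    where
    map : Carrier S → Carrier S
    map (n , a) = emb (ι n) a
    mono : Monotone S S map
    mono (n , a) (n' , b) (lt-idx r) = lt-idx (idxLt-along d (separated a b) (separated b a) r)
    mono (n , a) (n  , b) (lt-in r)  = emb-mono (ι n) a b r
    reflects : ∀ x y → lt S (map x) (map y) → lt S x y
    reflects (n , a) (n' , b) r with n ≟ n'
    ... | yes refl = lt-in (emb-reflects (ι n) a b r)
    ... | no n≢n'  = lt-idx (idxLt-back d (separated a b) (separated b a) (sumLt-blocks r) n≢n')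

  blocks-nondecreasing : (H : Carrier S → Carrier S) → Monotone S S H →
                         ∀ {j j'} a b → j < j' → proj₁ (H (j , a)) ≤ proj₁ (H (j' , b))
  blocks-nondecreasing H H-mono a b j<j' =
    idx-nondecreasing d j<j' (λ r → sumLt-blocks (H-mono _ _ (lt-idx r))) (λ r → sumLt-blocks (H-mono _ _ (lt-idx r)))

  -- By (*), S embeds into its part beyond any block j: block k goes into a
  -- block σ k > j receiving a copy of L_k, with σ strictly increasing.
  shiftBeyond : Star Ls → ∀ j → Σ (Embedding S S) λ τ → ∀ x → j < proj₁ (emb τ x)
  shiftBeyond st j = τ , beyond
    where
    σ : ℕ → ℕ
    σ zero    = proj₁ (st 0 (suc j))
    σ (suc k) = proj₁ (st (suc k) (suc (σ k)))
    σ-step : ∀ k → σ k < σ (suc k)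
    σ-step k = proj₁ (proj₂ (st (suc k) (suc (σ k))))
    copy : ∀ k → Embedding (Ls k) (Ls (σ k))
    copy zero    = embedding (proj₂ (proj₂ (st 0 (suc j))))
    copy (suc k) = embedding (proj₂ (proj₂ (st (suc k) (suc (σ k)))))
    ι : ∀ k → Embedding (Ls k) S
    ι k = blockInclusion (σ k) ∘ᵉ copy k
    σ-beyond : ∀ k → j < σ k
    σ-beyond zero    = proj₁ (proj₂ (st 0 (suc j)))
    σ-beyond (suc k) = <-trans (σ-beyond k) (σ-step k)
    τ : Embedding S S
    τ = blockwise ι (λ a b k<k' → increasing⇒strict σ σ-step k<k')
    beyond : ∀ x → j < proj₁ (emb τ x)
    beyond (k , _) = σ-beyond k

  intoBlock : ∀ {l} (p : Carrier S) → proj₁ p ≡ l → Carrier (Ls l)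
  intoBlock (i , a) refl = a

  intoBlock-mono : ∀ {l} p q (p∈l : proj₁ p ≡ l) (q∈l : proj₁ q ≡ l) → lt S p q →
                   lt (Ls l) (intoBlock p p∈l) (intoBlock q q∈l)
  intoBlock-mono (i , a) (.i , b) refl refl r = sumLt-within r

  -- If S maps monotonically into a single block L_l, that block doubles:
  -- by (*), two different blocks of S contain copies of L_l, one below the other.
  sumIntoBlock⇒doubles : Star Ls → ∀ l (E : Carrier S → Carrier (Ls l)) → Monotone S (Ls l) E → Doubles (Ls l)
  sumIntoBlock⇒doubles st l E E-mono = [ (λ r → below r e₁ e₂) , (λ r → below r e₂ e₁) ]′ (orient d j₁<j₂)
    where
    j₁ = proj₁ (st l 0)
    e₁ = proj₂ (proj₂ (st l 0))
    j₂ = proj₁ (st l (suc j₁))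
    e₂ = proj₂ (proj₂ (st l (suc j₁)))
    j₁<j₂ : j₁ < j₂
    j₁<j₂ = proj₁ (proj₂ (st l (suc j₁)))
    copyIn : ∀ {j} → Ls l ↪ Ls j → Embedding (Ls l) S
    copyIn {j} e = blockInclusion j ∘ᵉ embedding e
    below : ∀ {j j'} → IdxLt d j j' → Ls l ↪ Ls j → Ls l ↪ Ls j' → Doubles (Ls l)
    below r e e' = doubles-via (emb (copyIn e)) (emb (copyIn e')) E (emb-mono (copyIn e)) (emb-mono (copyIn e'))
                               (λ _ _ → lt-idx r) E-mono

H-inhabited : ∀ {X} → InH X → Carrier X
H-inhabited (one I)             = _≅_.from I tt
H-inhabited (sum d Ls hs st I) = _≅_.from I (0 , H-inhabited (hs 0))

H-trichotomous : ∀ {X} → InH X → Trichotomous X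
H-trichotomous (one I)             = trichotomous-≅ I (λ _ _ → inj₂ (inj₁ refl))
H-trichotomous (sum d Ls hs st I) = trichotomous-≅ I (SumOrder.sum-trichotomous d Ls (λ i → H-trichotomous (hs i)))

H-irreflexive : ∀ {X} → InH X → Irreflexive X
H-irreflexive (one I)             = irreflexive-emb (≅⇒emb I) (λ _ ())
H-irreflexive (sum d Ls hs st I) = irreflexive-emb (≅⇒emb I) (SumOrder.sum-irreflexive d Ls (λ i → H-irreflexive (hs i)))

∧-elim : ∀ a {b} → a ∧ b ≡ true → a ≡ true × b ≡ true
∧-elim true b≡true = refl , b≡true

∧-intro : ∀ {a b} → a ≡ true → b ≡ true → a ∧ b ≡ true
∧-intro refl refl = refl

sepLe-refl : (L : Ord) → ∀ A → SepLe L A A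
sepLe-refl L A C C∈P C⊆A = C , C∈P , λ x c → ∧-intro c (C⊆A x c)

sepLe-⊆ : (L : Ord) → ∀ {A A' B} → Sub⊆ L A A' → SepLe L A' B → SepLe L A B
sepLe-⊆ L A⊆A' A'≤B C C∈P C⊆A = A'≤B C C∈P (λ x c → A⊆A' x (C⊆A x c))

commonRefinement : (L : Ord) (p : ℕ → Subset L) → (∀ n → SepLe L (p (suc n)) (p n)) →
                   ∀ n C → InP L C → SepLe L C (p n) →
                   ∃[ D ] (InP L D × Sub⊆ L D C × (∀ j → j ≤ n → Sub⊆ L D (p j)))
commonRefinement L p p-dec zero C C∈P C≤p₀ with C≤p₀ C C∈P (λ _ c → c)
... | D , D∈P , D⊆C∩p₀ =
  D , D∈P , (λ x dx → proj₁ (∧-elim (C x) (D⊆C∩p₀ x dx))) , λ { .zero z≤n x dx → proj₂ (∧-elim (C x) (D⊆C∩p₀ x dx)) }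
commonRefinement L p p-dec (suc n) C C∈P C≤pₙ₊₁ with C≤pₙ₊₁ C C∈P (λ _ c → c)
... | D₁ , D₁∈P , D₁⊆C∩pₙ₊₁ with commonRefinement L p p-dec n D₁ D₁∈P (sepLe-⊆ L D₁⊆pₙ₊₁ (p-dec n))
  where
  D₁⊆pₙ₊₁ : Sub⊆ L D₁ (p (suc n))
  D₁⊆pₙ₊₁ x dx = proj₂ (∧-elim (C x) (D₁⊆C∩pₙ₊₁ x dx))
...   | D , D∈P , D⊆D₁ , D⊆p≤n = D , D∈P , D⊆C , D⊆p
  where
  D⊆C : Sub⊆ L D C
  D⊆C x dx = proj₁ (∧-elim (C x) (D₁⊆C∩pₙ₊₁ x (D⊆D₁ x dx)))
  D⊆p : ∀ j → j ≤ suc n → Sub⊆ L D (p j)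
  D⊆p j j≤n+1 with m≤n⇒m<n∨m≡n j≤n+1
  ... | inj₁ j<n+1 = D⊆p≤n j (m<1+n⇒m≤n j<n+1)
  ... | inj₂ refl  = λ x dx → proj₂ (∧-elim (C x) (D₁⊆C∩pₙ₊₁ x (D⊆D₁ x dx)))

-- Excluded middle is used to make images Boolean subsets and to decide whether
-- a bound on block indices is attained.
module Classical (em : ExcludedMiddle (Level.suc 0ℓ)) where

  decide : (P : Set) → Dec P
  decide P = map′ Level.lower Level.lift em

  image : {X : Ord} → Embedding X X → Subset X
  image e x = isYes (decide (∃[ y ] emb e y ≡ x))

  image-elim : {X : Ord} (e : Embedding X X) → ∀ x → image e x ≡ true → ∃[ y ] emb e y ≡ x
  image-elim e x x∈ = toWitness (Equivalence.from T-≡ x∈)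

  image-intro : {X : Ord} (e : Embedding X X) → ∀ y → image e (emb e y) ≡ true
  image-intro e y = Equivalence.to T-≡ (fromWitness (y , refl))

  image-inP : {X : Ord} → Trichotomous X → Irreflexive X → (e : Embedding X X) → InP X (image e)
  image-inP {X} tri irr e = record { to = to ; from = from ; from-to = from-to ; to-from = to-from ; to-< = to-< }
    where
    to : Carrier (X ∣ image e) → Carrier X
    to (x , x∈) = proj₁ (image-elim e x x∈)
    from : Carrier X → Carrier (X ∣ image e)
    from y = emb e y , image-intro e y
    from-to : ∀ x → from (to x) ≡ x
    from-to (x , x∈) = subset-≡ {X} {image e} (proj₂ (image-elim e x x∈))
    to-from : ∀ y → to (from y) ≡ y
    to-from y = emb-injective e tri irr _ _ (proj₂ (image-elim e (emb e y) (image-intro e y)))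
    to-< : ∀ x x' → lt (X ∣ image e) x x' ⇔ lt X (to x) (to x')
    to-< (x , x∈) (x' , x'∈) with image-elim e x x∈ | image-elim e x' x'∈
    ... | y , refl | y' , refl = mk⇔ (emb-reflects e y y') (emb-mono e y y')

  module BlockIndices (d : Dir) (Ls : ℕ → Ord) where
    open SumOrder d Ls

    -- A monotone self-map of S with block indices bounded by N eventually stays
    -- in one block: decide whether the largest value is attained, else lower N.
    eventuallyOneBlock : (H : Carrier S → Carrier S) → Monotone S S H → ∀ N → (∀ x → proj₁ (H x) ≤ N) →
                         ∃[ j ] ∃[ l ] (∀ x → j < proj₁ x → proj₁ (H x) ≡ l)
    eventuallyOneBlock H H-mono zero bounded = 0 , 0 , λ x _ → n≤0⇒n≡0 (bounded x)
    eventuallyOneBlock H H-mono (suc N) bounded with decide (∃[ x ] proj₁ (H x) ≡ suc N)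
    ... | yes ((j , a) , reached) = j , suc N , λ (j' , b) j<j' →
            ≤-antisym (bounded _) (subst (_≤ proj₁ (H (j' , b))) reached (blocks-nondecreasing H H-mono a b j<j'))
    ... | no never = eventuallyOneBlock H H-mono N (λ x → m<1+n⇒m≤n (≤∧≢⇒< (bounded x) (λ e → never (x , e))))

    -- Hence a monotone self-map with bounded block indices makes some block
    -- double: precomposed with a shift beyond the point where it settles in
    -- block l, it maps all of S into L_l.
    boundedSelfMap⇒doubles : Star Ls → (H : Carrier S → Carrier S) → Monotone S S H →
                             ∀ N → (∀ x → proj₁ (H x) ≤ N) → ∃[ l ] Doubles (Ls l)
    boundedSelfMap⇒doubles st H H-mono N bounded = l , sumIntoBlock⇒doubles st l E E-mono
      where
      j = proj₁ (eventuallyOneBlock H H-mono N bounded)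
      l = proj₁ (proj₂ (eventuallyOneBlock H H-mono N bounded))
      settled = proj₂ (proj₂ (eventuallyOneBlock H H-mono N bounded))
      τ = proj₁ (shiftBeyond st j)
      τ-beyond = proj₂ (shiftBeyond st j)
      inBlock-l : ∀ x → proj₁ (H (emb τ x)) ≡ l
      inBlock-l x = settled _ (τ-beyond x)
      E : Carrier S → Carrier (Ls l)
      E x = intoBlock (H (emb τ x)) (inBlock-l x)
      E-mono : Monotone S (Ls l) E
      E-mono x y r = intoBlock-mono _ _ (inBlock-l x) (inBlock-l y) (H-mono _ _ (emb-mono τ x y r))

  -- A sum of inhabited non-doubling blocks with (*) does not double: the lower
  -- copy (for ω), resp. the upper copy (for ω*), would have bounded block indices.
  sum-noDoubles : ∀ d Ls → Star Ls → (∀ l → Carrier (Ls l)) → (∀ l → ¬ Doubles (Ls l)) → ¬ Doubles (Sum d Ls)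
  sum-noDoubles ω Ls st inh noDoubles D =
    uncurry noDoubles (boundedSelfMap⇒doubles st left left-mono (proj₁ (right y₀)) bounded)
    where
    open SumOrder ω Ls
    open BlockIndices ω Ls
    open Doubles D
    y₀ = 0 , inh 0
    bounded : ∀ x → proj₁ (left x) ≤ proj₁ (right y₀)
    bounded x = [ <⇒≤ , ≤-reflexive ]′ (sumLt-blocks (left<right x y₀))
  sum-noDoubles ω* Ls st inh noDoubles D =
    uncurry noDoubles (boundedSelfMap⇒doubles st right right-mono (proj₁ (left x₀)) bounded)
    where
    open SumOrder ω* Ls
    open BlockIndices ω* Ls
    open Doubles D
    x₀ = 0 , inh 0
    bounded : ∀ y → proj₁ (right y) ≤ proj₁ (left x₀)
    bounded y = [ <⇒≤ , (λ e → ≤-reflexive (sym e)) ]′ (sumLt-blocks (left<right x₀ y))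

  H-noDoubles : ∀ {X} → InH X → ¬ Doubles X
  H-noDoubles (one I) D = emb-mono (≅⇒emb I) _ _ (Doubles.left<right D x x)
    where x = _≅_.from I tt
  H-noDoubles (sum d Ls hs st I) D =
    sum-noDoubles d Ls st (λ l → H-inhabited (hs l)) (λ l → H-noDoubles (hs l)) (doubles-≅ I D)

  module Criterion (d : Dir) (Ls : ℕ → Ord) (hs : ∀ i → InH (Ls i)) (st : Star Ls) where
    open SumOrder d Ls
    open BlockIndices d Ls

    S-trichotomous : Trichotomous S
    S-trichotomous = sum-trichotomous (λ i → H-trichotomous (hs i))

    S-irreflexive : Irreflexive S
    S-irreflexive = sum-irreflexive (λ i → H-irreflexive (hs i))

    unboundedBlocks : (H : Carrier S → Carrier S) → Monotone S S H → ∀ m → ∃[ x ] m ≤ proj₁ (H x)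
    unboundedBlocks H H-mono m with decide (∃[ x ] m ≤ proj₁ (H x))
    ... | yes reached = reached
    ... | no never    = ⊥-elim (uncurry (λ l → H-noDoubles (hs l)) (boundedSelfMap⇒doubles st H H-mono m bounded))
      where
      bounded : ∀ x → proj₁ (H x) ≤ m
      bounded x = <⇒≤ (≰⇒> (λ m≤ → never (x , m≤)))

    -- Let h be the self-embedding of S onto B ⊆ A.  Some point is
    -- sent beyond block m; by (*) a later block j₁ contains a copy of L_i, and h
    -- carries it into the blocks from m up to the block of h(j₁ + 1, ·).
    copy⇒spread : ∀ A → ContainsCopy A → Spread A
    copy⇒spread A (B , B≅S , B⊆A) i m = interval m N , interval-above m N , ↪-of (corestrict φ _ φ-in)
      where
      h : Embedding S S
      h = forget S B ∘ᵉ ≅⇒emb⁻¹ B≅S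
      x₀ = proj₁ (unboundedBlocks (emb h) (emb-mono h) m)
      m≤hx₀ = proj₂ (unboundedBlocks (emb h) (emb-mono h) m)
      j₁ = proj₁ (st i (suc (proj₁ x₀)))
      x₀<j₁ = proj₁ (proj₂ (st i (suc (proj₁ x₀))))
      φ : Embedding (Ls i) S
      φ = h ∘ᵉ (blockInclusion j₁ ∘ᵉ embedding (proj₂ (proj₂ (st i (suc (proj₁ x₀))))))
      N = proj₁ (emb h (suc j₁ , H-inhabited (hs (suc j₁))))
      φ-between : ∀ a → m ≤ proj₁ (emb φ a) × proj₁ (emb φ a) ≤ N
      φ-between a = ≤-trans m≤hx₀ (blocks-nondecreasing (emb h) (emb-mono h) (proj₂ x₀) _ x₀<j₁) ,
                    blocks-nondecreasing (emb h) (emb-mono h) _ _ ≤-refl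
      φ-in : ∀ a → Sub∩ S (U (interval m N)) A (emb φ a) ≡ true
      φ-in a = ∧-intro (∈⇒U (interval m N) (emb φ a) (uncurry interval-∋ (φ-between a)))
                       (B⊆A _ (proj₂ (emb (≅⇒emb⁻¹ B≅S) _)))

    -- The outcome of placing the blocks L_n one after another into subsets T n:
    -- a copy of S inside ⋃ T n, whose points in blocks ≥ threshold k come from
    -- blocks L_n with n ≥ k.
    record Assembly (T : ℕ → Subset S) : Set where
      field
        copy        : Subset S
        copy-inP    : InP S copy
        threshold   : ℕ → ℕ
        copy-source : ∀ x → copy x ≡ true → ∃[ n ] (T n x ≡ true × (∀ k → threshold k ≤ proj₁ x → k ≤ n))

    -- Block n goes into T n using finitely many blocks, all between M n and
    -- M (n + 1); the staircase M keeps the images of distinct blocks apart.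
    assemble : (T : ℕ → Subset S) → (∀ n m → FitsBeyond n m (T n)) → Assembly T
    assemble T fits = record
      { copy = image F ; copy-inP = image-inP S-trichotomous S-irreflexive F ; threshold = M ; copy-source = source }
      where
      M : ℕ → ℕ
      M zero    = 0
      M (suc n) = suc (M n ⊔ max 0 (proj₁ (fits n (M n))))
      K : ℕ → List ℕ
      K n = proj₁ (fits n (M n))
      g : ∀ n → Embedding (Ls n) (S ∣ Sub∩ S (U (K n)) (T n))
      g n = embedding (proj₂ (proj₂ (fits n (M n))))
      ι : ∀ n → Embedding (Ls n) S
      ι n = forget S _ ∘ᵉ g n
      ι-in : ∀ n a → proj₁ (emb (ι n) a) ∈ K n × T n (emb (ι n) a) ≡ true
      ι-in n a = map₁ (U⇒∈ (K n) (emb (ι n) a)) (∧-elim (U (K n) (emb (ι n) a)) (proj₂ (emb (g n) a)))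
      above : ∀ n a → M n ≤ proj₁ (emb (ι n) a)
      above n a = All.lookup (proj₁ (proj₂ (fits n (M n)))) (proj₁ (ι-in n a))
      below : ∀ n a → proj₁ (emb (ι n) a) < M (suc n)
      below n a = s≤s (≤-trans (All.lookup (xs≤max 0 (K n)) (proj₁ (ι-in n a))) (m≤n⊔m (M n) _))
      M-mono : ∀ {n n'} → n ≤ n' → M n ≤ M n'
      M-mono n≤n' with m≤n⇒m<n∨m≡n n≤n'
      ... | inj₁ n<n' = <⇒≤ (increasing⇒strict M (λ n → s≤s (m≤m⊔n (M n) _)) n<n')
      ... | inj₂ refl = ≤-refl
      F : Embedding S S
      F = blockwise ι (λ a b n<n' → <-≤-trans (below _ a) (≤-trans (M-mono n<n') (above _ b)))
      source : ∀ x → image F x ≡ true → ∃[ n ] (T n x ≡ true × (∀ k → M k ≤ proj₁ x → k ≤ n))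
      source x x∈ with image-elim F x x∈
      ... | (n , a) , refl = n , proj₂ (ι-in n a) ,
            λ k Mk≤ → ≮⇒≥ (λ n<k → <-irrefl refl (<-≤-trans (below n a) (≤-trans (M-mono n<k) Mk≤)))

    spread⇒copy : ∀ A → Spread A → ContainsCopy A
    spread⇒copy A spread = copy , copy-inP , λ x x∈ → proj₁ (proj₂ (copy-source x x∈))
      where open Assembly (assemble (λ _ → A) spread)

    copy-meetsLateBlocks : ∀ A → InP S A → ∀ n → ∃[ i ] (n ≤ i × ∃[ x ] (A (i , x) ≡ true))
    copy-meetsLateBlocks A A∈P n with copy⇒spread A (A , A∈P , λ _ a → a) 0 n
    ... | K , K≥n , φ with proj₁ φ (H-inhabited (hs 0))
    ...   | (i , x) , in-U∩A =
            i , All.lookup K≥n (U⇒∈ K (i , x) (proj₁ (∧-elim (U K (i , x)) in-U∩A))) , x , proj₂ (∧-elim (U K (i , x)) in-U∩A)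

    -- Part (b): A ≤ B says precisely that C ∩ B contains a copy of S for every
    -- copy C ⊆ A, so (a) applies to C ∩ B, up to regrouping the intersections.
    sepLe-criterion : ∀ A B → InP S A → InP S B →
                      SepLe S A B ⇔ (∀ C → InP S C → Sub⊆ S C A → ∀ i m →
                        ∃[ K ] (All (m ≤_) K × (Ls i ↪ (S ∣ Sub∩ S (Sub∩ S (U K) C) B))))
    sepLe-criterion A B _ _ = mk⇔
      (λ A≤B C C∈P C⊆A i m → regroup (copy⇒spread (Sub∩ S C B) (A≤B C C∈P C⊆A) i m))
      (λ crit C C∈P C⊆A → spread⇒copy (Sub∩ S C B) (λ i m → ungroup (crit C C∈P C⊆A i m)))
      where
      regroup : ∀ {C i m} → FitsBeyond i m (Sub∩ S C B) → ∃[ K ] (All (m ≤_) K × (Ls i ↪ (S ∣ Sub∩ S (Sub∩ S (U K) C) B)))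
      regroup {C} (K , K≥m , φ) = K , K≥m , enlarge S (λ x p → trans (∧-assoc (U K x) (C x) (B x)) p) φ
      ungroup : ∀ {C i m} → ∃[ K ] (All (m ≤_) K × (Ls i ↪ (S ∣ Sub∩ S (Sub∩ S (U K) C) B))) → FitsBeyond i m (Sub∩ S C B)
      ungroup {C} (K , K≥m , φ) = K , K≥m , enlarge S (λ x p → trans (sym (∧-assoc (U K x) (C x) (B x))) p) φ

    -- Refine the first n + 1 terms of p into sₙ and assemble, block n
    -- going into sₙ.  Beyond threshold k the copy lies in ⋃_{n ≥ k} sₙ ⊆ p k,
    -- so by (a) every copy C inside it meets p k in a copy of S.
    σ-closed : SigmaClosed S
    σ-closed p p∈P p-dec = copy , copy-inP , copy≤p
      where
      refinement : ∀ n → ∃[ D ] (InP S D × Sub⊆ S D (p n) × (∀ j → j ≤ n → Sub⊆ S D (p j)))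
      refinement n = commonRefinement S p p-dec n (p n) (p∈P n) (sepLe-refl S (p n))
      s : ℕ → Subset S
      s n = proj₁ (refinement n)
      open Assembly (assemble s (λ n → copy⇒spread (s n) (s n , proj₁ (proj₂ (refinement n)) , λ _ x → x) n))
      copy≤p : ∀ k → SepLe S copy (p k)
      copy≤p k C C∈P C⊆copy = spread⇒copy (Sub∩ S C (p k)) fits
        where
        fits : Spread (Sub∩ S C (p k))
        fits i m = K , All.map (≤-trans (m≤m⊔n m _)) K≥ , enlarge S in-pₖ φ
          where
          C-fits : FitsBeyond i (m ⊔ threshold k) C
          C-fits = copy⇒spread C (C , C∈P , λ _ c → c) i (m ⊔ threshold k)
          K = proj₁ C-fits
          K≥ = proj₁ (proj₂ C-fits)
          φ = proj₂ (proj₂ C-fits)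
          in-pₖ : Sub⊆ S (Sub∩ S (U K) C) (Sub∩ S (U K) (Sub∩ S C (p k)))
          in-pₖ x x∈U∩C = ∧-intro x∈U (∧-intro x∈C (sₙ⊆p k k≤n x x∈sₙ))
            where
            x∈U = proj₁ (∧-elim (U K x) x∈U∩C)
            x∈C = proj₂ (∧-elim (U K x) x∈U∩C)
            source = copy-source x (C⊆copy x x∈C)
            n = proj₁ source
            x∈sₙ : s n x ≡ true
            x∈sₙ = proj₁ (proj₂ source)
            sₙ⊆p : ∀ j → j ≤ n → Sub⊆ S (s n) (p j)
            sₙ⊆p = proj₂ (proj₂ (proj₂ (refinement n)))
            late : threshold k ≤ proj₁ x
            late = ≤-trans (m≤n⊔m m (threshold k)) (All.lookup K≥ (U⇒∈ K x x∈U))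
            k≤n : k ≤ n
            k≤n = proj₂ (proj₂ source) k late

proposition3p1 : ExcludedMiddle (Level.suc 0ℓ) →
    (d : Dir) (Ls : ℕ → Ord) → (∀ i → InH (Ls i)) → Star Ls →
    ((A : Subset (Sum d Ls)) →
        (∃[ B ] (InP (Sum d Ls) B × Sub⊆ (Sum d Ls) B A))
        ⇔ (∀ (i m : ℕ) → ∃[ K ] (All (m ≤_) K × (Ls i ↪ (Sum d Ls ∣ Sub∩ (Sum d Ls) (UnionK d Ls K) A)))))
    × ((A : Subset (Sum d Ls)) → InP (Sum d Ls) A →
        ∀ (n : ℕ) → ∃[ i ] (n ≤ i × ∃[ x ] (A (i , x) ≡ true)))
    × ((A B : Subset (Sum d Ls)) → InP (Sum d Ls) A → InP (Sum d Ls) B →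
        SepLe (Sum d Ls) A B
        ⇔ (∀ (C : Subset (Sum d Ls)) → InP (Sum d Ls) C → Sub⊆ (Sum d Ls) C A → ∀ (i m : ℕ) →
             ∃[ K ] (All (m ≤_) K × (Ls i ↪ (Sum d Ls ∣ Sub∩ (Sum d Ls) (Sub∩ (Sum d Ls) (UnionK d Ls K) C) B)))))
    × SigmaClosed (Sum d Ls)
proposition3p1 em d Ls hs st =
    (λ A → mk⇔ (copy⇒spread A) (spread⇒copy A))
  , copy-meetsLateBlocks
  , sepLe-criterion
  , σ-closed
  where
  open Classical em
  open Criterion d Ls hs st
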